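{- Let $m\ge 2$ be an integer and $k=5m$. Then $va_3^{\equiv}(K_{4k,4k,4k})\leq 12m-3$.
   Context: All graphs are finite and simple. A $t$-coloring of a graph $G$ is a map $f:V(G)\to\{1,\dots,t\}$, with color classes $V_i=\{v: f(v)=i\}$. It is equitable if $\big||V_i|-|V_j|\big|\le 1$ for all $i,j$. A $(t,k)$-tree-coloring of $G$ is a $t$-coloring such that every connected component of each induced subgraph $G[V_i]$ is a tree of maximum degree at most $k$; an equitable $(t,k)$-tree-coloring is a $(t,k)$-tree-coloring that is equitable. The strong equitable vertex $k$-arboricity $va_k^{\equiv}(G)$ is the smallest integer $t$ such that $G$ has an equitable $(t',k)$-tree-coloring for every integer $t'\ge t$. $K_{n,n,n}$ denotes the complete tripartite graph whose three partite sets each have exactly $n$ vertices. -}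

module Defs where

open import Data.Nat using (ℕ; _≤_; _*_; _∸_; _+_)
open import Data.Bool using (Bool; true; false; not; _∧_)
open import Data.Fin using (Fin; quotient)
open import Data.Fin.Properties using (_≟_)
open import Data.List using (List; []; _∷_; length; filterᵇ; _∷ʳ_)
open import Data.List.Relation.Unary.All using (All)
open import Data.List.Relation.Unary.Linked using (Linked)
open import Data.List.Relation.Unary.Unique.Propositional using (Unique)
open import Data.List.Membership.Propositional using (_∈_)
open import Data.Product using (Σ; _×_; ∃)
open import Data.Empty using (⊥)
open import Relation.Nullary using (¬_)
open import Relation.Nullary.Decidable using (⌊_⌋)
open import Relation.Binary.PropositionalEquality using (_≡_)

record Graph (n : ℕ) : Set where
  field
    adj   : Fin n → Fin n → Bool
    sym   : ∀ u v → adj u v ≡ adj v u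
    irrefl : ∀ v → adj v v ≡ false
open Graph public

Adj : ∀ {n} → Graph n → Fin n → Fin n → Set
Adj G u v = adj G u v ≡ true

vertices : (n : ℕ) → List (Fin n)
vertices n = Data.List.allFin n

-- a t-coloring (colors are Fin t, i.e. 0..t-1 instead of 1..t)
Coloring : ℕ → ℕ → Set
Coloring n t = Fin n → Fin t

classSize : ∀ {n t} → Coloring n t → Fin t → ℕ
classSize {n} f i = length (filterᵇ (λ v → ⌊ f v ≟ i ⌋) (vertices n))

Equitable : ∀ {n t} → Coloring n t → Set
Equitable {t = t} f = ∀ (i j : Fin t) → classSize f i ≤ classSize f j + 1

classDegree : ∀ {n t} → Graph n → Coloring n t → Fin n → ℕ
classDegree {n} G f v =
  length (filterᵇ (λ u → adj G u v ∧ ⌊ f u ≟ f v ⌋) (vertices n))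

-- a cycle of G contained in the color class V_i : distinct vertices
-- x, x₁, …, x_l (l ≥ 2, so length ≥ 3), consecutive ones adjacent,
-- and the last one adjacent to x.
CycleInClass : ∀ {n t} → Graph n → Coloring n t → Fin t → Set
CycleInClass {n} G f i =
  Σ (Fin n) λ x → Σ (List (Fin n)) λ xs →
    (2 ≤ length xs) × Unique (x ∷ xs) × All (λ v → f v ≡ i) (x ∷ xs)
    × Linked (Adj G) ((x ∷ xs) ∷ʳ x)

-- (t,k)-tree-coloring: every component of every G[V_i] is a tree of
-- maximum degree ≤ k, i.e. every G[V_i] is acyclic (a forest) and every
-- vertex has at most k neighbours in its own color class.
TreeColoring : ∀ {n t} → Graph n → ℕ → Coloring n t → Set
TreeColoring {t = t} G k f =
  (∀ (i : Fin t) → ¬ CycleInClass G f i) × (∀ v → classDegree G f v ≤ k)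

HasEqTreeColoring : ∀ {n} → Graph n → ℕ → ℕ → Set
HasEqTreeColoring {n} G t k =
  Σ (Coloring n t) λ f → Equitable f × TreeColoring G k f

-- va_k^≡(G) ≤ T : since va_k^≡(G) is the least t such that G has an
-- equitable (t',k)-tree-coloring for every t' ≥ t, and this property is
-- upward closed in t, va_k^≡(G) ≤ T iff the property holds at T.
StrongEqVA≤ : ∀ {n} → Graph n → ℕ → ℕ → Set
StrongEqVA≤ G k T = ∀ (t' : ℕ) → T ≤ t' → HasEqTreeColoring G t' k

part : (n : ℕ) → Fin (3 * n) → Fin 3
part n v = quotient n v

K3 : (n : ℕ) → Graph (3 * n)
K3 n = record
  { adj = λ u v → not ⌊ part n u ≟ part n v ⌋
  ; sym = λ u v → symLemma u v
  ; irrefl = λ v → irr v }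
  where
  open import Relation.Binary.PropositionalEquality renaming (sym to ≡sym) using (refl)
  open import Relation.Nullary using (yes; no)
  symLemma : ∀ u v → not ⌊ part n u ≟ part n v ⌋ ≡ not ⌊ part n v ≟ part n u ⌋
  symLemma u v with part n u ≟ part n v | part n v ≟ part n u
  ... | yes _ | yes _ = refl
  ... | no _  | no _  = refl
  ... | yes p | no q = Data.Empty.⊥-elim (q (≡sym p))
  ... | no p  | yes q = Data.Empty.⊥-elim (p (≡sym q))
  irr : ∀ v → not ⌊ part n v ≟ part n v ⌋ ≡ false
  irr v with part n v ≟ part n v
  ... | yes _ = refl
  ... | no p = Data.Empty.⊥-elim (p refl)

-- Number the vertices of K_{n,n,n} (n = 20m) by 0, …, 3n − 1, so that vertex x lies in part
-- x / n, and take every color class to be an interval of consecutive vertices, all of sizes q or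
-- q + 1 (so the coloring is equitable).  A class inside one part is independent; a class of at
-- most three consecutive vertices meets at most two consecutive parts, so it contains no cycle and
-- has maximum degree at most 2.  For t ≥ n all intervals have length at most 3.  For t = n − 1 three
-- intervals of length 4 fit into the first part and the rest have length 3.  For
-- 12m − 3 ≤ t ≤ n − 2 the t classes are shared among the three parts in near-thirds c, and each part
-- is cut into c intervals of lengths q, q + 1, where q = 5, 4, 3 for t ≤ 12m, t ≤ 15m, t > 15m.

module Submission where

open import Data.Bool using (Bool; true; false; _∧_; T)
open import Data.Bool.Properties using (T-∧; T-≡)
open import Data.Empty using (⊥; ⊥-elim)
open import Data.Fin as Fin using (Fin; toℕ; fromℕ<)
open import Data.Fin.Properties using (toℕ-fromℕ<; toℕ-injective; toℕ<n; toℕ-combine; combine-remQuot)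
open import Data.List using (List; []; _∷_; length; filterᵇ; tabulate; replicate; _++_; allFin; concat; map)
open import Data.List.Properties using (length-++; length-replicate)
open import Data.List.Relation.Unary.All using (All; []; _∷_)
open import Data.List.Relation.Unary.All.Properties using (++⁺; replicate⁺; concat⁺)
open import Data.List.Relation.Unary.AllPairs using ([]; _∷_)
open import Data.List.Relation.Unary.Linked using ([]; [-]; _∷_)
open import Data.Nat
open import Data.Nat.DivMod
open import Data.Nat.ListAction using (sum)
open import Data.Nat.ListAction.Properties using (sum-++)
open import Data.Nat.Properties
open import Data.Nat.Tactic.RingSolver using (solve-∀)
open import Data.Product using (∃; _×_; _,_; proj₁; proj₂)
open import Data.Sum using (_⊎_; inj₁; inj₂)
open import Function using (_∘_; id; mk⇔; Equivalence)
open import Relation.Binary.Definitions using (Tri; tri<; tri≈; tri>)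
open import Relation.Binary.PropositionalEquality
open import Relation.Nullary using (¬_; yes; no)
open import Relation.Nullary.Decidable using (⌊_⌋; toWitness; does-⇔; isYes≗does)

open import Defs hiding (sym)

-- Counting

bool→ℕ : Bool → ℕ
bool→ℕ true = 1
bool→ℕ false = 0

countBelow : (ℕ → Bool) → ℕ → ℕ
countBelow p zero = 0
countBelow p (suc N) = bool→ℕ (p 0) + countBelow (p ∘ suc) N

countBelow-+ : ∀ p M K → countBelow p (M + K) ≡ countBelow p M + countBelow (λ x → p (M + x)) K
countBelow-+ p zero K = refl
countBelow-+ p (suc M) K = begin
  bool→ℕ (p 0) + countBelow (p ∘ suc) (M + K)
    ≡⟨ cong (bool→ℕ (p 0) +_) (countBelow-+ (p ∘ suc) M K) ⟩
  bool→ℕ (p 0) + (countBelow (p ∘ suc) M + countBelow (λ x → p (suc M + x)) K)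
    ≡⟨ +-assoc (bool→ℕ (p 0)) _ _ ⟨
  bool→ℕ (p 0) + countBelow (p ∘ suc) M + countBelow (λ x → p (suc M + x)) K ∎
  where open ≡-Reasoning

countBelow-cong : ∀ {p p′} N → (∀ x → x < N → p x ≡ p′ x) → countBelow p N ≡ countBelow p′ N
countBelow-cong zero eq = refl
countBelow-cong (suc N) eq =
  cong₂ _+_ (cong bool→ℕ (eq 0 z<s)) (countBelow-cong N (λ x x<N → eq (suc x) (s<s x<N)))

countBelow-false : ∀ N → countBelow (λ _ → false) N ≡ 0
countBelow-false zero = refl
countBelow-false (suc N) = countBelow-false N

countBelow-true : ∀ N → countBelow (λ _ → true) N ≡ N
countBelow-true zero = refl
countBelow-true (suc N) = cong suc (countBelow-true N)

length-filterᵇ-∷ : ∀ {A : Set} (p : A → Bool) x xs →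
                   length (filterᵇ p (x ∷ xs)) ≡ bool→ℕ (p x) + length (filterᵇ p xs)
length-filterᵇ-∷ p x xs with p x
... | true = refl
... | false = refl

length-filterᵇ-tabulate : ∀ {M} N (p : Fin M → Bool) (g : ℕ → Bool) (e : Fin N → Fin M) →
                          (∀ j → p (e j) ≡ g (toℕ j)) →
                          length (filterᵇ p (tabulate e)) ≡ countBelow g N
length-filterᵇ-tabulate zero p g e eq = refl
length-filterᵇ-tabulate (suc N) p g e eq = trans (length-filterᵇ-∷ p (e Fin.zero) _)
  (cong₂ _+_ (cong bool→ℕ (eq Fin.zero))
             (length-filterᵇ-tabulate N p (g ∘ suc) (e ∘ Fin.suc) (eq ∘ Fin.suc)))

length-filterᵇ-mono : ∀ {A : Set} {p p′ : A → Bool} xs → (∀ x → T (p x) → T (p′ x)) →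
                      length (filterᵇ p xs) ≤ length (filterᵇ p′ xs)
length-filterᵇ-mono [] p⇒p′ = z≤n
length-filterᵇ-mono {p = p} {p′} (x ∷ xs) p⇒p′ with p x in px | p′ x in p′x
... | true  | true  = s≤s (length-filterᵇ-mono xs p⇒p′)
... | false | true  = m≤n⇒m≤1+n (length-filterᵇ-mono xs p⇒p′)
... | false | false = length-filterᵇ-mono xs p⇒p′
... | true  | false = ⊥-elim (subst T p′x (p⇒p′ x (subst T (sym px) _)))

length-filterᵇ-false : ∀ {A : Set} (xs : List A) → length (filterᵇ (λ _ → false) xs) ≡ 0
length-filterᵇ-false [] = refl
length-filterᵇ-false (x ∷ xs) = length-filterᵇ-false xs

⌊≟⌋≡toℕ≡ᵇ : ∀ {k} (a b : Fin k) → ⌊ a Fin.≟ b ⌋ ≡ (toℕ a ≡ᵇ toℕ b)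
⌊≟⌋≡toℕ≡ᵇ a b = trans (isYes≗does (a Fin.≟ b))
  (does-⇔ (mk⇔ (cong toℕ) toℕ-injective) (a Fin.≟ b) (toℕ a ≟ toℕ b))

-- Consecutive blocks of integers

m<n+o⇒m∸n<o′ : ∀ {m n o} → n ≤ m → m < n + o → m ∸ n < o
m<n+o⇒m∸n<o′ {n = n} n≤m m<n+o = +-cancelˡ-< n _ _ (subst (_< n + _) (sym (m+[n∸m]≡n n≤m)) m<n+o)

blockOf : List ℕ → ℕ → ℕ
blockOf [] x = 0
blockOf (ℓ ∷ ls) x with x <? ℓ
... | yes _ = 0
... | no _ = suc (blockOf ls (x ∸ ℓ))

blockSize : List ℕ → ℕ → ℕ
blockSize [] i = 0
blockSize (ℓ ∷ ls) zero = ℓ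
blockSize (ℓ ∷ ls) (suc i) = blockSize ls i

blockStart : List ℕ → ℕ → ℕ
blockStart ls zero = 0
blockStart [] (suc i) = 0
blockStart (ℓ ∷ ls) (suc i) = ℓ + blockStart ls i

blockOf-head : ∀ ℓ ls {x} → x < ℓ → blockOf (ℓ ∷ ls) x ≡ 0
blockOf-head ℓ ls {x} x<ℓ with x <? ℓ
... | yes _ = refl
... | no x≮ℓ = ⊥-elim (x≮ℓ x<ℓ)

blockOf-tail : ∀ ℓ ls {x} → ℓ ≤ x → blockOf (ℓ ∷ ls) x ≡ suc (blockOf ls (x ∸ ℓ))
blockOf-tail ℓ ls {x} ℓ≤x with x <? ℓ
... | yes x<ℓ = ⊥-elim (<⇒≱ x<ℓ ℓ≤x)
... | no _ = refl

blockOf<length : ∀ ls {x} → x < sum ls → blockOf ls x < length ls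
blockOf<length (ℓ ∷ ls) {x} x<sum with x <? ℓ
... | yes _ = z<s
... | no x≮ℓ = s<s (blockOf<length ls (m<n+o⇒m∸n<o′ (≮⇒≥ x≮ℓ) x<sum))

blockOf-within : ∀ ls {x} → x < sum ls → let i = blockOf ls x in
                 blockStart ls i ≤ x × x < blockStart ls i + blockSize ls i
blockOf-within (ℓ ∷ ls) {x} x<sum with x <? ℓ
... | yes x<ℓ = z≤n , x<ℓ
... | no x≮ℓ = lower , upper
  where
  open ≤-Reasoning
  ℓ≤x = ≮⇒≥ x≮ℓ
  i = blockOf ls (x ∸ ℓ)
  within = blockOf-within ls (m<n+o⇒m∸n<o′ ℓ≤x x<sum)
  lower : ℓ + blockStart ls i ≤ x
  lower = begin
    ℓ + blockStart ls i ≤⟨ +-monoʳ-≤ ℓ (proj₁ within) ⟩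
    ℓ + (x ∸ ℓ)         ≡⟨ m+[n∸m]≡n ℓ≤x ⟩
    x                   ∎
  upper : x < ℓ + blockStart ls i + blockSize ls i
  upper = begin-strict
    x                                      ≡⟨ m+[n∸m]≡n ℓ≤x ⟨
    ℓ + (x ∸ ℓ)                            <⟨ +-monoʳ-< ℓ (proj₂ within) ⟩
    ℓ + (blockStart ls i + blockSize ls i) ≡⟨ +-assoc ℓ _ _ ⟨
    ℓ + blockStart ls i + blockSize ls i   ∎

countBelow-blockOf : ∀ ls i → countBelow (λ x → blockOf ls x ≡ᵇ i) (sum ls) ≡ blockSize ls i
countBelow-blockOf [] i = refl
countBelow-blockOf (ℓ ∷ ls) i = trans (countBelow-+ _ ℓ (sum ls)) (split i)
  where
  inHead : ∀ i → countBelow (λ x → blockOf (ℓ ∷ ls) x ≡ᵇ i) ℓ ≡ countBelow (λ _ → 0 ≡ᵇ i) ℓ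
  inHead i = countBelow-cong ℓ (λ x x<ℓ → cong (_≡ᵇ i) (blockOf-head ℓ ls x<ℓ))
  inTail : ∀ i → countBelow (λ y → blockOf (ℓ ∷ ls) (ℓ + y) ≡ᵇ i) (sum ls)
               ≡ countBelow (λ y → suc (blockOf ls y) ≡ᵇ i) (sum ls)
  inTail i = countBelow-cong (sum ls) (λ y _ → cong (_≡ᵇ i)
    (trans (blockOf-tail ℓ ls (m≤m+n ℓ y)) (cong (suc ∘ blockOf ls) (m+n∸m≡n ℓ y))))
  split : ∀ i → countBelow (λ x → blockOf (ℓ ∷ ls) x ≡ᵇ i) ℓ
              + countBelow (λ y → blockOf (ℓ ∷ ls) (ℓ + y) ≡ᵇ i) (sum ls) ≡ blockSize (ℓ ∷ ls) i
  split zero = trans (cong₂ _+_ (trans (inHead 0) (countBelow-true ℓ))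
                                (trans (inTail 0) (countBelow-false (sum ls)))) (+-identityʳ ℓ)
  split (suc i) = trans (cong₂ _+_ (trans (inHead (suc i)) (countBelow-false ℓ)) (inTail (suc i)))
                        (countBelow-blockOf ls i)

blockOf-++ˡ : ∀ A B {x} → x < sum A → blockOf (A ++ B) x ≡ blockOf A x
blockOf-++ˡ (ℓ ∷ A) B {x} x<sum with x <? ℓ
... | yes _ = refl
... | no x≮ℓ = cong suc (blockOf-++ˡ A B (m<n+o⇒m∸n<o′ (≮⇒≥ x≮ℓ) x<sum))

blockOf-++ʳ : ∀ A B {x} → sum A ≤ x → blockOf (A ++ B) x ≡ length A + blockOf B (x ∸ sum A)
blockOf-++ʳ [] B _ = refl
blockOf-++ʳ (ℓ ∷ A) B {x} sum≤x = begin
  blockOf (ℓ ∷ A ++ B) x                       ≡⟨ blockOf-tail ℓ (A ++ B) ℓ≤x ⟩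
  suc (blockOf (A ++ B) (x ∸ ℓ))               ≡⟨ cong suc (blockOf-++ʳ A B A≤x∸ℓ) ⟩
  suc (length A + blockOf B (x ∸ ℓ ∸ sum A))   ≡⟨ cong (λ y → suc (length A + blockOf B y)) (∸-+-assoc x ℓ (sum A)) ⟩
  suc (length A + blockOf B (x ∸ (ℓ + sum A))) ∎
  where
  open ≡-Reasoning
  ℓ≤x = ≤-trans (m≤m+n ℓ (sum A)) sum≤x
  A≤x∸ℓ = m+n≤o⇒m≤o∸n (sum A) (subst (_≤ x) (+-comm ℓ (sum A)) sum≤x)

blockSize-++ˡ : ∀ A B {i} → i < length A → blockSize (A ++ B) i ≡ blockSize A i
blockSize-++ˡ (ℓ ∷ A) B {zero} _ = refl
blockSize-++ˡ (ℓ ∷ A) B {suc i} i<len = blockSize-++ˡ A B (s<s⁻¹ i<len)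

blockSize-++ʳ : ∀ A B j → blockSize (A ++ B) (length A + j) ≡ blockSize B j
blockSize-++ʳ [] B j = refl
blockSize-++ʳ (ℓ ∷ A) B j = blockSize-++ʳ A B j

All-blockSize : ∀ {P : ℕ → Set} {ls i} → All P ls → i < length ls → P (blockSize ls i)
All-blockSize {i = zero} (p ∷ _) _ = p
All-blockSize {i = suc i} (_ ∷ ps) i<len = All-blockSize ps (s<s⁻¹ i<len)

InWindow : ℕ → ℕ → Set
InWindow s x = s ≤ x × x ≤ 2 + s

smallBlock⇒InWindow : ∀ ls {x y} → x < sum ls → y < sum ls → blockOf ls y ≡ blockOf ls x →
                      blockSize ls (blockOf ls x) ≤ 3 → InWindow (blockStart ls (blockOf ls x)) y
smallBlock⇒InWindow ls x<sum y<sum y∼x small with blockOf-within ls y<sum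
... | start≤y , y<end rewrite y∼x =
  start≤y , s≤s⁻¹ (≤-trans y<end (≤-trans (+-monoʳ-≤ _ small) (≤-reflexive (+-comm _ 3))))

-- Parts of K_{n,n,n}

n*k≤m<n*[1+k]⇒m/n≡k : ∀ {m n k} .{{_ : NonZero n}} → n * k ≤ m → m < n * suc k → m / n ≡ k
n*k≤m<n*[1+k]⇒m/n≡k {m} {n} {k} lower upper = ≤-antisym
  (s≤s⁻¹ (m<n*o⇒m/o<n (subst (m <_) (*-comm n (suc k)) upper)))
  (subst (_≤ m / n) (m*n/n≡m k n) (/-monoˡ-≤ n (subst (_≤ m) (*-comm n k) lower)))

m/o<n/o⇒m<n : ∀ {m n o} .{{_ : NonZero o}} → m / o < n / o → m < n
m/o<n/o⇒m<n {o = o} lt = ≰⇒> (λ n≤m → <⇒≱ lt (/-monoˡ-≤ o n≤m))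

m≤2+n⇒m/o≤1+n/o : ∀ {m n o} .{{_ : NonZero o}} → 3 ≤ o → m ≤ 2 + n → m / o ≤ suc (n / o)
m≤2+n⇒m/o≤1+n/o {m} {n} {o} 3≤o m≤2+n = begin
  m / o           ≤⟨ /-monoˡ-≤ o (≤-trans m≤2+n (+-monoˡ-≤ n (≤-trans (n≤1+n 2) 3≤o))) ⟩
  (o + n) / o     ≡⟨ m/n≡1+[m∸n]/n (m≤m+n o n) ⟩
  suc ((o + n ∸ o) / o) ≡⟨ cong (λ k → suc (k / o)) (m+n∸m≡n o n) ⟩
  suc (n / o)     ∎
  where open ≤-Reasoning

toℕ-part : ∀ n .{{_ : NonZero n}} v → toℕ (part n v) ≡ toℕ v / n
toℕ-part n v = sym (n*k≤m<n*[1+k]⇒m/n≡k lower upper)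
  where
  open ≤-Reasoning
  q = toℕ (Fin.quotient {3} n v)
  r = toℕ (Fin.remainder {3} n v)
  v≡ : toℕ v ≡ n * q + r
  v≡ = trans (cong toℕ (sym (combine-remQuot {3} n v)))
             (toℕ-combine (Fin.quotient {3} n v) (Fin.remainder {3} n v))
  lower : n * q ≤ toℕ v
  lower = subst (n * q ≤_) (sym v≡) (m≤m+n (n * q) r)
  upper : toℕ v < n * suc q
  upper = begin-strict
    toℕ v     ≡⟨ v≡ ⟩
    n * q + r <⟨ +-monoʳ-< (n * q) (toℕ<n (Fin.remainder {3} n v)) ⟩
    n * q + n ≡⟨ +-comm (n * q) n ⟩
    n + n * q ≡⟨ *-suc n q ⟨
    n * suc q ∎

adj⇒/≢ : ∀ n .{{_ : NonZero n}} {u v} → Adj (K3 n) u v → toℕ u / n ≢ toℕ v / n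
adj⇒/≢ n {u} {v} uv u≡v with part n u Fin.≟ part n v | uv
... | no u≢v | _ = u≢v (toℕ-injective (trans (toℕ-part n u) (trans u≡v (sym (toℕ-part n v)))))

Near : ℕ → ℕ → Set
Near a b = a ≤ suc b × b ≤ suc a

near-≢⇒suc : ∀ {a b} → Near a b → a ≢ b → a ≡ suc b ⊎ b ≡ suc a
near-≢⇒suc {a} {b} (a≤1+b , b≤1+a) a≢b with <-cmp a b
... | tri< a<b _ _ = inj₂ (≤-antisym b≤1+a a<b)
... | tri≈ _ a≡b _ = ⊥-elim (a≢b a≡b)
... | tri> _ _ b<a = inj₁ (≤-antisym a≤1+b b<a)

near-≢⇒≡ : ∀ {a b c} → Near a b → Near c b → Near a c → a ≢ b → c ≢ b → a ≡ c
near-≢⇒≡ ab cb (a≤1+c , c≤1+a) a≢b c≢b with near-≢⇒suc ab a≢b | near-≢⇒suc cb c≢b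
... | inj₁ a≡1+b | inj₁ c≡1+b = trans a≡1+b (sym c≡1+b)
... | inj₂ b≡1+a | inj₂ b≡1+c = suc-injective (trans (sym b≡1+a) b≡1+c)
... | inj₁ refl  | inj₂ refl  = ⊥-elim (1+n≰n (s≤s⁻¹ a≤1+c))
... | inj₂ refl  | inj₁ refl  = ⊥-elim (1+n≰n (s≤s⁻¹ c≤1+a))

two-below⇒2+≤ : ∀ {s a c b} → s ≤ a → s ≤ c → a ≢ c → a < b → c < b → 2 + s ≤ b
two-below⇒2+≤ s≤a s≤c a≢c a<b c<b with <-cmp _ _
... | tri< a<c _ _ = ≤-trans (s<s (≤-<-trans s≤a a<c)) c<b
... | tri≈ _ a≡c _ = ⊥-elim (a≢c a≡c)
... | tri> _ _ c<a = ≤-trans (s<s (≤-<-trans s≤c c<a)) a<b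

module _ {n s : ℕ} .{{_ : NonZero n}} (3≤n : 3 ≤ n) where

  private
    near : ∀ {x y} → InWindow s x → InWindow s y → Near (x / n) (y / n)
    near (s≤x , x≤2+s) (s≤y , y≤2+s) =
      m≤2+n⇒m/o≤1+n/o 3≤n (≤-trans x≤2+s (+-monoʳ-≤ 2 s≤y)) ,
      m≤2+n⇒m/o≤1+n/o 3≤n (≤-trans y≤2+s (+-monoʳ-≤ 2 s≤x))

    separated : ∀ {a b c d} → InWindow s a → InWindow s b → InWindow s c → InWindow s d →
                a / n ≡ c / n → b / n ≡ d / n → a / n < b / n → a ≢ c → b ≢ d → ⊥
    separated {a} {b} {c} {d} wa wb wc wd ac bd a/n<b/n a≢c b≢d = b≢d (≤-antisym
      (≤-trans (proj₂ wb) (two-below⇒2+≤ (proj₁ wa) (proj₁ wc) a≢c a<d c<d))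
      (≤-trans (proj₂ wd) (two-below⇒2+≤ (proj₁ wa) (proj₁ wc) a≢c a<b c<b)))
      where
      a<b = m/o<n/o⇒m<n a/n<b/n
      a<d = m/o<n/o⇒m<n (subst (a / n <_) bd a/n<b/n)
      c<b = m/o<n/o⇒m<n (subst (_< b / n) ac a/n<b/n)
      c<d = m/o<n/o⇒m<n (subst₂ _<_ ac bd a/n<b/n)

  -- Three consecutive vertices meet at most two consecutive parts, so a–b–c–d alternates
  -- between them and the two vertices in the lower part lie below both in the upper part;
  -- four distinct values do not fit into a window of three.
  noPathInWindow : ∀ {a b c d} → InWindow s a → InWindow s b → InWindow s c → InWindow s d →
                   a / n ≢ b / n → b / n ≢ c / n → c / n ≢ d / n → a ≢ c → b ≢ d → ⊥
  noPathInWindow {a} {b} {c} {d} wa wb wc wd ab bc cd a≢c b≢d = compareParts (<-cmp (a / n) (b / n))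
    where
    ac = near-≢⇒≡ (near wa wb) (near wc wb) (near wa wc) ab (≢-sym bc)
    bd = near-≢⇒≡ (near wb wc) (near wd wc) (near wb wd) bc (≢-sym cd)
    compareParts : Tri (a / n < b / n) (a / n ≡ b / n) (a / n > b / n) → ⊥
    compareParts (tri< a<b _ _) = separated wa wb wc wd ac bd a<b a≢c b≢d
    compareParts (tri≈ _ a≡b _) = ab a≡b
    compareParts (tri> _ _ b<a) = separated wb wa wd wc bd ac b<a b≢d a≢c

-- Block layouts

-- The blocks of ls are laid out on the vertices o, o + 1, …; vertex y lies in part y / n.
BlockInOnePart : (n : ℕ) .{{_ : NonZero n}} → ℕ → List ℕ → ℕ → Set
BlockInOnePart n o ls x = ∀ {y} → y < sum ls → blockOf ls y ≡ blockOf ls x → (o + y) / n ≡ (o + x) / n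

BlockSmallOrInOnePart : (n : ℕ) .{{_ : NonZero n}} → ℕ → List ℕ → ℕ → Set
BlockSmallOrInOnePart n o ls x = blockSize ls (blockOf ls x) ≤ 3 ⊎ BlockInOnePart n o ls x

record SmallOrInOnePart (n : ℕ) .{{_ : NonZero n}} (o : ℕ) (ls : List ℕ) : Set where
  constructor blockwise
  field
    blockAt : ∀ {x} → x < sum ls → BlockSmallOrInOnePart n o ls x
open SmallOrInOnePart

module _ {n : ℕ} .{{_ : NonZero n}} where

  small⇒SmallOrInOnePart : ∀ {o ls} → All (_≤ 3) ls → SmallOrInOnePart n o ls
  small⇒SmallOrInOnePart {ls = ls} small =
    blockwise λ x<sum → inj₁ (All-blockSize small (blockOf<length ls x<sum))

  inOnePart⇒SmallOrInOnePart : ∀ {o ls} p → n * p ≤ o → o + sum ls ≤ n * suc p →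
                              SmallOrInOnePart n o ls
  inOnePart⇒SmallOrInOnePart {o} p n*p≤o end≤ =
    blockwise λ x<sum → inj₂ (λ y<sum _ → trans (inPart y<sum) (sym (inPart x<sum)))
    where
    inPart : ∀ {y} → y < _ → (o + y) / n ≡ p
    inPart {y} y<sum =
      n*k≤m<n*[1+k]⇒m/n≡k (≤-trans n*p≤o (m≤m+n o y)) (<-≤-trans (+-monoʳ-< o y<sum) end≤)

  private
    ++-inLeft : ∀ {o} A B {x} → SmallOrInOnePart n o A → x < sum A → BlockSmallOrInOnePart n o (A ++ B) x
    ++-inLeft {o} A B {x} okA x<A with blockAt okA x<A
    ... | inj₁ small = inj₁ (subst (_≤ 3) (sym (trans (cong (blockSize (A ++ B)) x∈i)
                                  (blockSize-++ˡ A B (blockOf<length A x<A)))) small)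
      where x∈i = blockOf-++ˡ A B x<A
    ... | inj₂ inPart = inj₂ same
      where
      open ≤-Reasoning
      x∈i = blockOf-++ˡ A B x<A
      same : BlockInOnePart n o (A ++ B) x
      same {y} y<sum y∼x with y <? sum A
      ... | yes y<A = inPart y<A (trans (sym (blockOf-++ˡ A B y<A)) (trans y∼x x∈i))
      ... | no y≮A = ⊥-elim (<⇒≱ (blockOf<length A x<A) (begin
              length A                           ≤⟨ m≤m+n (length A) _ ⟩
              length A + blockOf B (y ∸ sum A)   ≡⟨ blockOf-++ʳ A B (≮⇒≥ y≮A) ⟨
              blockOf (A ++ B) y                 ≡⟨ trans y∼x x∈i ⟩
              blockOf A x                        ∎))

    ++-inRight : ∀ {o} A B {x} → SmallOrInOnePart n (o + sum A) B → sum A ≤ x → x < sum (A ++ B) →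
                 BlockSmallOrInOnePart n o (A ++ B) x
    ++-inRight {o} A B {x} okB A≤x x<sum
      with blockAt okB (m<n+o⇒m∸n<o′ A≤x (subst (x <_) (sum-++ A B) x<sum))
    ... | inj₁ small = inj₁ (subst (_≤ 3) (sym (trans (cong (blockSize (A ++ B)) x∈j)
                                  (blockSize-++ʳ A B _))) small)
      where x∈j = blockOf-++ʳ A B A≤x
    ... | inj₂ inPart = inj₂ same
      where
      x∈j = blockOf-++ʳ A B A≤x
      shift : ∀ {y} → sum A ≤ y → o + sum A + (y ∸ sum A) ≡ o + y
      shift A≤y = trans (+-assoc o _ _) (cong (o +_) (m+[n∸m]≡n A≤y))
      same : BlockInOnePart n o (A ++ B) x
      same {y} y<sum y∼x with y <? sum A
      ... | yes y<A = ⊥-elim (<⇒≱ (blockOf<length A y<A) (begin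
              length A                           ≤⟨ m≤m+n (length A) _ ⟩
              length A + blockOf B (x ∸ sum A)   ≡⟨ x∈j ⟨
              blockOf (A ++ B) x                 ≡⟨ y∼x ⟨
              blockOf (A ++ B) y                 ≡⟨ blockOf-++ˡ A B y<A ⟩
              blockOf A y                        ∎))
        where open ≤-Reasoning
      ... | no y≮A = subst₂ (λ a b → a / n ≡ b / n) (shift A≤y) (shift A≤x)
                            (inPart (m<n+o⇒m∸n<o′ A≤y (subst (y <_) (sum-++ A B) y<sum)) y∼x′)
        where
        A≤y = ≮⇒≥ y≮A
        y∼x′ = +-cancelˡ-≡ (length A) _ _ (trans (sym (blockOf-++ʳ A B A≤y)) (trans y∼x x∈j))

  SmallOrInOnePart-++ : ∀ {o} A B → SmallOrInOnePart n o A → SmallOrInOnePart n (o + sum A) B →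
                        SmallOrInOnePart n o (A ++ B)
  SmallOrInOnePart-++ {o} A B okA okB = blockwise atBlock
    where
    atBlock : ∀ {x} → x < sum (A ++ B) → BlockSmallOrInOnePart n o (A ++ B) x
    atBlock {x} x<sum with x <? sum A
    ... | yes x<A = ++-inLeft A B okA x<A
    ... | no x≮A = ++-inRight A B okB (≮⇒≥ x≮A) x<sum

-- Colorings by blocks

record Path₃InClass {k t} (G : Graph k) (f : Coloring k t) (i : Fin t) : Set where
  field
    a b c d : Fin k
    inClass : All (λ v → f v ≡ i) (a ∷ b ∷ c ∷ d ∷ [])
    ab : Adj G a b
    bc : Adj G b c
    cd : Adj G c d
    a≢c : a ≢ c
    b≢d : b ≢ d

-- The first four vertices of the cycle, with d = a for a triangle.
cycle⇒path₃ : ∀ {k t} {G : Graph k} {f : Coloring k t} {i} → CycleInClass G f i → Path₃InClass G f i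
cycle⇒path₃ (_ , [] , () , _)
cycle⇒path₃ (_ , _ ∷ [] , s≤s () , _)
cycle⇒path₃ (x , x₁ ∷ x₂ ∷ [] , _ , (x≢x₁ ∷ x≢x₂ ∷ []) ∷ _ ,
             fx ∷ fx₁ ∷ fx₂ ∷ [] , e₀₁ ∷ e₁₂ ∷ e₂₀ ∷ _) =
  record { a = x ; b = x₁ ; c = x₂ ; d = x ; inClass = fx ∷ fx₁ ∷ fx₂ ∷ fx ∷ []
         ; ab = e₀₁ ; bc = e₁₂ ; cd = e₂₀ ; a≢c = x≢x₂ ; b≢d = ≢-sym x≢x₁ }
cycle⇒path₃ (x , x₁ ∷ x₂ ∷ x₃ ∷ _ , _ , (_ ∷ x≢x₂ ∷ _) ∷ (_ ∷ x₁≢x₃ ∷ _) ∷ _ ,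
             fx ∷ fx₁ ∷ fx₂ ∷ fx₃ ∷ _ , e₀₁ ∷ e₁₂ ∷ e₂₃ ∷ _) =
  record { a = x ; b = x₁ ; c = x₂ ; d = x₃ ; inClass = fx ∷ fx₁ ∷ fx₂ ∷ fx₃ ∷ []
         ; ab = e₀₁ ; bc = e₁₂ ; cd = e₂₃ ; a≢c = x≢x₂ ; b≢d = x₁≢x₃ }

module BlockColoring {n t : ℕ} .{{_ : NonZero n}} (3≤n : 3 ≤ n) (ls : List ℕ)
                      (sum≡ : sum ls ≡ 3 * n) (length≡ : length ls ≡ t) where

  index<sum : ∀ (v : Fin (3 * n)) → toℕ v < sum ls
  index<sum v = subst (toℕ v <_) (sym sum≡) (toℕ<n v)

  color : Coloring (3 * n) t
  color v = fromℕ< (subst (blockOf ls (toℕ v) <_) length≡ (blockOf<length ls (index<sum v)))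

  toℕ-color : ∀ v → toℕ (color v) ≡ blockOf ls (toℕ v)
  toℕ-color v = toℕ-fromℕ< _

  sameBlock : ∀ {u v} → color u ≡ color v → blockOf ls (toℕ u) ≡ blockOf ls (toℕ v)
  sameBlock {u} {v} eq = trans (sym (toℕ-color u)) (trans (cong toℕ eq) (toℕ-color v))

  classSize-color : ∀ i → classSize color i ≡ blockSize ls (toℕ i)
  classSize-color i = begin
    classSize color i                               ≡⟨ length-filterᵇ-tabulate (3 * n) _ _ id sameℕ ⟩
    countBelow (λ x → blockOf ls x ≡ᵇ toℕ i) (3 * n)  ≡⟨ cong (countBelow _) sum≡ ⟨
    countBelow (λ x → blockOf ls x ≡ᵇ toℕ i) (sum ls) ≡⟨ countBelow-blockOf ls (toℕ i) ⟩
    blockSize ls (toℕ i)                             ∎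
    where
    open ≡-Reasoning
    sameℕ : ∀ v → ⌊ color v Fin.≟ i ⌋ ≡ (blockOf ls (toℕ v) ≡ᵇ toℕ i)
    sameℕ v = trans (⌊≟⌋≡toℕ≡ᵇ (color v) i) (cong (_≡ᵇ toℕ i) (toℕ-color v))

  equitable : ∀ {q} → All (λ ℓ → q ≤ ℓ × ℓ ≤ suc q) ls → Equitable color
  equitable {q} sizes i j = begin
    classSize color i       ≡⟨ classSize-color i ⟩
    blockSize ls (toℕ i)     ≤⟨ proj₂ (size i) ⟩
    suc q                    ≡⟨ +-comm 1 q ⟩
    q + 1                    ≤⟨ +-monoˡ-≤ 1 (proj₁ (size j)) ⟩
    blockSize ls (toℕ j) + 1 ≡⟨ cong (_+ 1) (classSize-color j) ⟨
    classSize color j + 1   ∎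
    where
    open ≤-Reasoning
    size : ∀ k → q ≤ blockSize ls (toℕ k) × blockSize ls (toℕ k) ≤ suc q
    size k = All-blockSize sizes (subst (toℕ k <_) (sym length≡) (toℕ<n k))

  module _ (layout : SmallOrInOnePart n 0 ls) where

    noPath₃ : ∀ {i} → Path₃InClass (K3 n) color i → ⊥
    noPath₃ {i} record { a = a ; b = b ; c = c ; d = d ; inClass = fa ∷ fb ∷ fc ∷ fd ∷ []
                   ; ab = ab ; bc = bc ; cd = cd ; a≢c = a≢c ; b≢d = b≢d }
      with blockAt layout (index<sum a)
    ... | inj₁ small = noPathInWindow 3≤n (window fa) (window fb) (window fc) (window fd)
                         (adj⇒/≢ n ab) (adj⇒/≢ n bc) (adj⇒/≢ n cd)
                         (a≢c ∘ toℕ-injective) (b≢d ∘ toℕ-injective)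
      where
      window : ∀ {v} → color v ≡ i → InWindow _ (toℕ v)
      window {v} fv = smallBlock⇒InWindow ls (index<sum a) (index<sum v) (sameBlock (trans fv (sym fa))) small
    ... | inj₂ inPart = adj⇒/≢ n ab (sym (inPart (index<sum b) (sameBlock (trans fb (sym fa)))))

    degree≤3 : ∀ v → classDegree (K3 n) color v ≤ 3
    degree≤3 v with blockAt layout (index<sum v)
    ... | inj₁ small = begin
      classDegree (K3 n) color v          ≤⟨ length-filterᵇ-mono (allFin (3 * n)) sameColor ⟩
      classSize color (color v)          ≡⟨ classSize-color (color v) ⟩
      blockSize ls (toℕ (color v))        ≡⟨ cong (blockSize ls) (toℕ-color v) ⟩
      blockSize ls (blockOf ls (toℕ v))    ≤⟨ small ⟩
      3                                    ∎
      where
      open ≤-Reasoning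
      sameColor : ∀ u → T (adj (K3 n) u v ∧ ⌊ color u Fin.≟ color v ⌋) → T ⌊ color u Fin.≟ color v ⌋
      sameColor _ = proj₂ ∘ Equivalence.to T-∧
    ... | inj₂ inPart = begin
      classDegree (K3 n) color v                      ≤⟨ length-filterᵇ-mono (allFin (3 * n)) notAdjacent ⟩
      length (filterᵇ (λ _ → false) (allFin (3 * n))) ≡⟨ length-filterᵇ-false (allFin (3 * n)) ⟩
      0                                                ≤⟨ z≤n ⟩
      3                                                ∎
      where
      open ≤-Reasoning
      notAdjacent : ∀ u → T (adj (K3 n) u v ∧ ⌊ color u Fin.≟ color v ⌋) → ⊥
      notAdjacent u uv with Equivalence.to T-∧ uv
      ... | adjacent , same = adj⇒/≢ n (Equivalence.to T-≡ adjacent)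
                                (inPart (index<sum u) (sameBlock (toWitness same)))

    noCycle : ∀ i → ¬ CycleInClass (K3 n) color i
    noCycle i = noPath₃ ∘ cycle⇒path₃

blockColoring : ∀ {n t q} .{{_ : NonZero n}} → 3 ≤ n →
                (ls : List ℕ) → sum ls ≡ 3 * n → length ls ≡ t →
                All (λ ℓ → q ≤ ℓ × ℓ ≤ suc q) ls → SmallOrInOnePart n 0 ls →
                HasEqTreeColoring (K3 n) t 3
blockColoring 3≤n ls sum≡ length≡ sizes layout =
  color , equitable sizes , noCycle layout , degree≤3 layout
  where open BlockColoring 3≤n ls sum≡ length≡

-- Balanced block lengths

record Splits (q N c : ℕ) : Set where
  constructor split
  field
    lower : q * c ≤ N
    upper : N ≤ suc q * c

-- When Splits q N c holds, these c sizes sum to N; the N ∸ q * c blocks of size q + 1 come first.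
balanced : ℕ → ℕ → ℕ → List ℕ
balanced q N c = replicate (N ∸ q * c) (suc q) ++ replicate (c ∸ (N ∸ q * c)) q

sum-replicate : ∀ k x → sum (replicate k x) ≡ k * x
sum-replicate zero x = refl
sum-replicate (suc k) x = cong (x +_) (sum-replicate k x)

replicate⁺′ : ∀ {P : ℕ → Set} k {x : ℕ} → (0 < k → P x) → All P (replicate k x)
replicate⁺′ zero _ = []
replicate⁺′ (suc k) P-x = replicate⁺ (suc k) (P-x z<s)

balanced-sizes : ∀ q N c → All (λ ℓ → q ≤ ℓ × ℓ ≤ suc q) (balanced q N c)
balanced-sizes q N c =
  ++⁺ (replicate⁺ (N ∸ q * c) (n≤1+n q , ≤-refl)) (replicate⁺ (c ∸ (N ∸ q * c)) (≤-refl , n≤1+n q))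

/-Splits : ∀ N c .{{_ : NonZero c}} → Splits (N / c) N c
/-Splits N c = split (m/n*n≤m N c) (begin
  N                 ≡⟨ m≡m%n+[m/n]*n N c ⟩
  N % c + N / c * c ≤⟨ +-monoˡ-≤ (N / c * c) (m%n≤n N c) ⟩
  c + N / c * c     ∎)
  where open ≤-Reasoning

module _ {q N c : ℕ} (splits : Splits q N c) where

  private
    r = N ∸ q * c
    r≤c : r ≤ c
    r≤c = m≤n+o⇒m∸n≤o N (q * c) (subst (N ≤_) (+-comm c (q * c)) (Splits.upper splits))

  balanced-length : length (balanced q N c) ≡ c
  balanced-length = begin
    length (replicate r (suc q) ++ replicate (c ∸ r) q)
      ≡⟨ length-++ (replicate r (suc q)) ⟩
    length (replicate r (suc q)) + length (replicate (c ∸ r) q)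
      ≡⟨ cong₂ _+_ (length-replicate r) (length-replicate (c ∸ r)) ⟩
    r + (c ∸ r)
      ≡⟨ m+[n∸m]≡n r≤c ⟩
    c ∎
    where open ≡-Reasoning

  balanced-sum : sum (balanced q N c) ≡ N
  balanced-sum = begin
    sum (replicate r (suc q) ++ replicate (c ∸ r) q)
      ≡⟨ sum-++ (replicate r (suc q)) _ ⟩
    sum (replicate r (suc q)) + sum (replicate (c ∸ r) q)
      ≡⟨ cong₂ _+_ (sum-replicate r (suc q)) (sum-replicate (c ∸ r) q) ⟩
    r * suc q + (c ∸ r) * q
      ≡⟨ redistribute r (c ∸ r) q ⟩
    r + q * (r + (c ∸ r))
      ≡⟨ cong (λ k → r + q * k) (m+[n∸m]≡n r≤c) ⟩
    r + q * c
      ≡⟨ m∸n+n≡m (Splits.lower splits) ⟩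
    N ∎
    where
    open ≡-Reasoning
    redistribute : ∀ r d q → r * suc q + d * q ≡ r + q * (r + d)
    redistribute = solve-∀

  balanced-≤ : ∀ {b} → N ≤ b * c → All (_≤ b) (balanced q N c)
  balanced-≤ {b} N≤bc = ++⁺ (replicate⁺′ r {suc q} large≤b) (replicate⁺′ (c ∸ r) {q} small≤b)
    where
    large≤b : 0 < r → suc q ≤ b
    large≤b 0<r = *-cancelʳ-< c q b (<-≤-trans (m∸n≢0⇒n<m (≢-sym (<⇒≢ 0<r))) N≤bc)
    small≤b : 0 < c ∸ r → q ≤ b
    small≤b 0<c∸r = *-cancelʳ-≤ q b c {{>-nonZero 0<c}} (≤-trans (Splits.lower splits) N≤bc)
      where 0<c = ≤-<-trans z≤n (m∸n≢0⇒n<m {c} {r} (≢-sym (<⇒≢ 0<c∸r)))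

sum-concat : ∀ {n} Ls → All (λ L → sum L ≡ n) Ls → sum (concat Ls) ≡ length Ls * n
sum-concat [] [] = refl
sum-concat (L ∷ Ls) (sum≡n ∷ sums) = trans (sum-++ L (concat Ls)) (cong₂ _+_ sum≡n (sum-concat Ls sums))

length-concat : ∀ {A : Set} (Ls : List (List A)) → length (concat Ls) ≡ sum (map length Ls)
length-concat [] = refl
length-concat (L ∷ Ls) = trans (length-++ L) (cong (length L +_) (length-concat Ls))

concatParts⇒SmallOrInOnePart : ∀ {n} .{{_ : NonZero n}} p Ls → All (λ L → sum L ≡ n) Ls →
                               SmallOrInOnePart n (n * p) (concat Ls)
concatParts⇒SmallOrInOnePart p [] [] = small⇒SmallOrInOnePart []
concatParts⇒SmallOrInOnePart {n} p (L ∷ Ls) (sum≡n ∷ sums) =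
  SmallOrInOnePart-++ L (concat Ls) (inOnePart⇒SmallOrInOnePart p ≤-refl (≤-reflexive next≡))
    (subst (λ o → SmallOrInOnePart n o (concat Ls)) (sym next≡) (concatParts⇒SmallOrInOnePart (suc p) Ls sums))
  where
  next≡ : n * p + sum L ≡ n * suc p
  next≡ = trans (cong (n * p +_) sum≡n) (trans (+-comm (n * p) n) (sym (*-suc n p)))

-- Equitable tree-colorings of K_{n,n,n}

nonZero-of-3≤ : ∀ {n} → 3 ≤ n → NonZero n
nonZero-of-3≤ 3≤n = >-nonZero (≤-trans (s≤s z≤n) 3≤n)

eqTreeColoring-n≤t : ∀ {n t} → 3 ≤ n → n ≤ t → HasEqTreeColoring (K3 n) t 3
eqTreeColoring-n≤t {n} {t} 3≤n n≤t =
  blockColoring 3≤n ls (balanced-sum splits) (balanced-length splits) (balanced-sizes (3 * n / t) (3 * n) t)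
    (small⇒SmallOrInOnePart (balanced-≤ splits (*-monoʳ-≤ 3 n≤t)))
  where
  instance
    nonZero-n : NonZero n
    nonZero-n = nonZero-of-3≤ 3≤n
    nonZero-t : NonZero t
    nonZero-t = nonZero-of-3≤ (≤-trans 3≤n n≤t)
  splits = /-Splits (3 * n) t
  ls = balanced ((3 * n) / t) (3 * n) t

eqTreeColoring-1+t≡n : ∀ {n t} → 12 ≤ n → suc t ≡ n → HasEqTreeColoring (K3 n) t 3
eqTreeColoring-1+t≡n {t = t} 12≤n refl =
  blockColoring 3≤n (balanced 3 (3 * suc t) t) (balanced-sum splits) (balanced-length splits)
    (balanced-sizes 3 (3 * suc t) t) layout
  where
  3≤n = ≤-trans (m≤m+n 3 9) 12≤n
  instance
    nonZero-n : NonZero (suc t)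
    nonZero-n = _
  large≡3 : 3 * suc t ∸ 3 * t ≡ 3
  large≡3 = trans (cong (_∸ 3 * t) (*-suc 3 t)) (m+n∸n≡m 3 (3 * t))
  splits : Splits 3 (3 * suc t) t
  splits = split (*-monoʳ-≤ 3 (n≤1+n t)) (begin
    3 * suc t   ≡⟨ *-suc 3 t ⟩
    3 + 3 * t   ≤⟨ +-monoˡ-≤ (3 * t) (s≤s⁻¹ (≤-trans (m≤m+n 4 8) 12≤n)) ⟩
    t + 3 * t   ∎)
    where open ≤-Reasoning
  large = replicate (3 * suc t ∸ 3 * t) 4
  small = replicate (t ∸ (3 * suc t ∸ 3 * t)) 3
  layout : SmallOrInOnePart (suc t) 0 (large ++ small)
  layout = SmallOrInOnePart-++ large small
    (inOnePart⇒SmallOrInOnePart {ls = large} 0 (≤-reflexive (*-zeroʳ (suc t))) (begin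
      sum large                   ≡⟨ sum-replicate (3 * suc t ∸ 3 * t) 4 ⟩
      (3 * suc t ∸ 3 * t) * 4     ≡⟨ cong (_* 4) large≡3 ⟩
      12                          ≤⟨ 12≤n ⟩
      suc t                       ≡⟨ *-identityʳ (suc t) ⟨
      suc t * 1                   ∎))
    (small⇒SmallOrInOnePart {ls = small} (replicate⁺ _ ≤-refl))
    where open ≤-Reasoning

eqTreeColoring-pureParts : ∀ {n q c₀ c₁ c₂} → 3 ≤ n → Splits q n c₀ → Splits q n c₁ → Splits q n c₂ →
                            HasEqTreeColoring (K3 n) (c₀ + (c₁ + c₂)) 3
eqTreeColoring-pureParts {n} {q} {c₀} {c₁} {c₂} 3≤n s₀ s₁ s₂ =
  blockColoring 3≤n (concat parts) (sum-concat parts sums) length≡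
    (concat⁺ (balanced-sizes q n c₀ ∷ balanced-sizes q n c₁ ∷ balanced-sizes q n c₂ ∷ []))
    (subst (λ o → SmallOrInOnePart n o (concat parts)) (*-zeroʳ n) (concatParts⇒SmallOrInOnePart 0 parts sums))
  where
  instance
    nonZero-n : NonZero n
    nonZero-n = nonZero-of-3≤ 3≤n
  parts = balanced q n c₀ ∷ balanced q n c₁ ∷ balanced q n c₂ ∷ []
  sums = balanced-sum s₀ ∷ balanced-sum s₁ ∷ balanced-sum s₂ ∷ []
  length≡ : length (concat parts) ≡ c₀ + (c₁ + c₂)
  length≡ = trans (length-concat parts)
    (cong₂ _+_ (balanced-length s₀) (cong₂ _+_ (balanced-length s₁)
      (trans (+-identityʳ _) (balanced-length s₂))))

-- Sharing the classes among the three parts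

record NearThird (t c : ℕ) : Set where
  constructor nearThird
  field
    3c≤t+2 : 3 * c ≤ t + 2
    t≤3c+2 : t ≤ 3 * c + 2

nearThird-3+ : ∀ {t c} → NearThird t c → NearThird (3 + t) (suc c)
nearThird-3+ {t} {c} (nearThird 3c≤t+2 t≤3c+2) = nearThird
  (subst (_≤ 3 + t + 2) (sym (*-suc 3 c)) (+-monoʳ-≤ 3 3c≤t+2))
  (subst (3 + t ≤_) (cong (_+ 2) (sym (*-suc 3 c))) (+-monoʳ-≤ 3 t≤3c+2))

record Thirds (t : ℕ) : Set where
  field
    c₀ c₁ c₂ : ℕ
    sum≡ : c₀ + (c₁ + c₂) ≡ t
    near₀ : NearThird t c₀
    near₁ : NearThird t c₁
    near₂ : NearThird t c₂

thirds : ∀ t → Thirds t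
thirds 0 = record { c₀ = 0 ; c₁ = 0 ; c₂ = 0 ; sum≡ = refl
                  ; near₀ = nearThird z≤n z≤n
                  ; near₁ = nearThird z≤n z≤n
                  ; near₂ = nearThird z≤n z≤n }
thirds 1 = record { c₀ = 1 ; c₁ = 0 ; c₂ = 0 ; sum≡ = refl
                  ; near₀ = nearThird ≤-refl (m≤m+n 1 4)
                  ; near₁ = nearThird z≤n (m≤m+n 1 1)
                  ; near₂ = nearThird z≤n (m≤m+n 1 1) }
thirds 2 = record { c₀ = 1 ; c₁ = 1 ; c₂ = 0 ; sum≡ = refl
                  ; near₀ = nearThird (m≤m+n 3 1) (m≤m+n 2 3)
                  ; near₁ = nearThird (m≤m+n 3 1) (m≤m+n 2 3)
                  ; near₂ = nearThird z≤n ≤-refl }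
thirds (suc (suc (suc t))) = record
  { c₀ = suc c₀ ; c₁ = suc c₁ ; c₂ = suc c₂
  ; sum≡ = trans (sum-suc c₀ c₁ c₂) (cong (3 +_) sum≡)
  ; near₀ = nearThird-3+ near₀ ; near₁ = nearThird-3+ near₁ ; near₂ = nearThird-3+ near₂ }
  where
  open Thirds (thirds t)
  sum-suc : ∀ a b c → suc a + (suc b + suc c) ≡ 3 + (a + (b + c))
  sum-suc = solve-∀

nearThird-≤ : ∀ {t c B} → NearThird t c → t ≤ 3 * B → c ≤ B
nearThird-≤ {t} {c} {B} (nearThird 3c≤t+2 _) t≤3B = s≤s⁻¹ (*-cancelˡ-< 3 c (suc B) (begin-strict
  3 * c      ≤⟨ 3c≤t+2 ⟩
  t + 2      ≤⟨ +-monoˡ-≤ 2 t≤3B ⟩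
  3 * B + 2  <⟨ +-monoʳ-< (3 * B) (n<1+n 2) ⟩
  3 * B + 3  ≡⟨ +-comm (3 * B) 3 ⟩
  3 + 3 * B  ≡⟨ *-suc 3 B ⟨
  3 * suc B  ∎))
  where open ≤-Reasoning

nearThird-≥ : ∀ {t c B} → NearThird t c → 3 * B ≤ t → B ≤ c
nearThird-≥ {t} {c} {B} (nearThird _ t≤3c+2) 3B≤t = s≤s⁻¹ (*-cancelˡ-< 3 B (suc c) (begin-strict
  3 * B      ≤⟨ 3B≤t ⟩
  t          ≤⟨ t≤3c+2 ⟩
  3 * c + 2  <⟨ +-monoʳ-< (3 * c) (n<1+n 2) ⟩
  3 * c + 3  ≡⟨ +-comm (3 * c) 3 ⟩
  3 + 3 * c  ≡⟨ *-suc 3 c ⟨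
  3 * suc c  ∎))
  where open ≤-Reasoning

eqTreeColoring-thirds : ∀ {n q t} → 3 ≤ n → (∀ {c} → NearThird t c → Splits q n c) →
                         HasEqTreeColoring (K3 n) t 3
eqTreeColoring-thirds {n} {t = t} 3≤n split-near = subst (λ t → HasEqTreeColoring (K3 n) t 3) sum≡
  (eqTreeColoring-pureParts 3≤n (split-near near₀) (split-near near₁) (split-near near₂))
  where open Thirds (thirds t)

40≤20m : ∀ {m} → 2 ≤ m → 40 ≤ 4 * (5 * m)
40≤20m 2≤m = *-monoʳ-≤ 4 (*-monoʳ-≤ 5 2≤m)

3≤20m : ∀ {m} → 2 ≤ m → 3 ≤ 4 * (5 * m)
3≤20m 2≤m = ≤-trans (m≤m+n 3 37) (40≤20m 2≤m)

module _ (m : ℕ) {t c : ℕ} (near : NearThird t c) where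

  private
    open ≤-Reasoning
    3[4m] : 12 * m ≡ 3 * (4 * m)
    3[4m] = *-assoc 3 4 m
    3[5m] : 15 * m ≡ 3 * (5 * m)
    3[5m] = *-assoc 3 5 m
    4[5m] : 4 * (5 * m) ≡ 5 * (4 * m)
    4[5m] = trans (sym (*-assoc 4 5 m)) (*-assoc 5 4 m)

  -- Integrality of c is needed: 12m ≤ t + 3 ≤ 3c + 5 gives 4m ≤ c + 1, hence 6c ≥ 24m − 6 ≥ 20m.
  splits₅ : 2 ≤ m → 12 * m ∸ 3 ≤ t → t ≤ 12 * m → Splits 5 (4 * (5 * m)) c
  splits₅ 2≤m lower t≤12m = split
    (≤-trans (*-monoʳ-≤ 5 (nearThird-≤ {B = 4 * m} near (subst (t ≤_) 3[4m] t≤12m)))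
             (≤-reflexive (sym 4[5m])))
    (+-cancelʳ-≤ 6 _ _ (begin
      4 * (5 * m) + 6      ≤⟨ +-monoʳ-≤ (4 * (5 * m)) (≤-trans (m≤m+n 6 2) (*-monoʳ-≤ 4 2≤m)) ⟩
      4 * (5 * m) + 4 * m  ≡⟨ regroup m ⟩
      6 * (4 * m)          ≤⟨ *-monoʳ-≤ 6 4m≤1+c ⟩
      6 * suc c            ≡⟨ *-suc 6 c ⟩
      6 + 6 * c            ≡⟨ +-comm 6 (6 * c) ⟩
      6 * c + 6            ∎))
    where
    12m≤3+t : 3 * (4 * m) ≤ 3 + t
    12m≤3+t = subst (_≤ 3 + t) 3[4m] (≤-trans (m≤n+m∸n (12 * m) 3) (+-monoʳ-≤ 3 lower))
    4m≤1+c : 4 * m ≤ suc c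
    4m≤1+c = nearThird-≥ {B = 4 * m} (nearThird-3+ near) 12m≤3+t
    regroup : ∀ m → 4 * (5 * m) + 4 * m ≡ 6 * (4 * m)
    regroup = solve-∀

  splits₄ : 12 * m < t → t ≤ 15 * m → Splits 4 (4 * (5 * m)) c
  splits₄ 12m<t t≤15m = split
    (*-monoʳ-≤ 4 (nearThird-≤ {B = 5 * m} near (subst (t ≤_) 3[5m] t≤15m)))
    (begin
      4 * (5 * m)  ≡⟨ 4[5m] ⟩
      5 * (4 * m)  ≤⟨ *-monoʳ-≤ 5 (nearThird-≥ {B = 4 * m} near (subst (_≤ t) 3[4m] (<⇒≤ 12m<t))) ⟩
      5 * c        ∎)

  splits₃ : 15 * m < t → 2 + t ≤ 4 * (5 * m) → Splits 3 (4 * (5 * m)) c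
  splits₃ 15m<t 2+t≤n = split
    (≤-trans (NearThird.3c≤t+2 near) (≤-trans (≤-reflexive (+-comm t 2)) 2+t≤n))
    (*-monoʳ-≤ 4 (nearThird-≥ {B = 5 * m} near (subst (_≤ t) 3[5m] (<⇒≤ 15m<t))))

splitsByRange : ∀ {m t} → 2 ≤ m → 12 * m ∸ 3 ≤ t → 2 + t ≤ 4 * (5 * m) →
                ∃ λ q → ∀ {c} → NearThird t c → Splits q (4 * (5 * m)) c
splitsByRange {m} {t} 2≤m lower upper with t ≤? 12 * m | t ≤? 15 * m
... | yes t≤12m | _        = 5 , λ near → splits₅ m near 2≤m lower t≤12m
... | no t≰12m | yes t≤15m = 4 , λ near → splits₄ m near (≰⇒> t≰12m) t≤15m
... | no _     | no t≰15m  = 3 , λ near → splits₃ m near (≰⇒> t≰15m) upper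

lemma7 : (m : ℕ) → 2 ≤ m → let k = 5 * m in
    StrongEqVA≤ (K3 (4 * k)) 3 (12 * m ∸ 3)
lemma7 m 2≤m t lower with <-cmp (suc t) (4 * (5 * m))
... | tri< 2+t≤n _ _ = eqTreeColoring-thirds (3≤20m 2≤m) (proj₂ (splitsByRange 2≤m lower 2+t≤n))
... | tri≈ _ 1+t≡n _ = eqTreeColoring-1+t≡n (≤-trans (m≤m+n 12 28) (40≤20m 2≤m)) 1+t≡n
... | tri> _ _ n<1+t = eqTreeColoring-n≤t (3≤20m 2≤m) (s≤s⁻¹ n<1+t)
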